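{- Let $\ell\ge 1$ be an integer and let $\mathcal C$ be a hereditary class of finite graphs such that every graph in $\mathcal C$ has an equitable partition into $\ell$ induced forests. Then for every integer $k\ge \ell$, every graph in $\mathcal C$ has an equitable partition into $k$ induced forests.
   Context: A class of graphs is hereditary if it is closed under taking induced subgraphs. An equitable partition of a graph $G$ into $m$ parts is a partition of its vertex set into $m$ sets $S_1,\dots,S_m$ (some possibly empty) with $||S_i|-|S_j||\le 1$ for all $i,j$; it is a partition into induced forests if each part induces a forest (acyclic graph) in $G$. -}

module Defs where

open import Data.Nat using (ℕ; suc; _≤_; _+_)
open import Data.Fin using (Fin; zero; suc; inject₁; fromℕ; _≟_)
open import Data.Bool using (Bool; true; false)
open import Data.Product using (Σ; _×_)
open import Function.Definitions using (Injective)
open import Relation.Binary.PropositionalEquality using (_≡_)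
open import Relation.Nullary using (¬_)
import Data.List as L

record Graph : Set where
  field
    size   : ℕ
    adj    : Fin size → Fin size → Bool
    sym    : ∀ u v → adj u v ≡ adj v u
    irrefl : ∀ v → adj v v ≡ false
open Graph public

_≤ind_ : Graph → Graph → Set
H ≤ind G = Σ (Fin (size H) → Fin (size G)) λ f →
  Injective _≡_ _≡_ f × (∀ u v → adj G (f u) (f v) ≡ adj H u v)

Hereditary : (Graph → Set) → Set
Hereditary C = ∀ G H → C G → H ≤ind G → C H

-- A cycle of length m+3 in G: distinct vertices c 0, …, c (m+2) with
-- consecutive ones adjacent and c (m+2) adjacent to c 0.
record Cycle (G : Graph) : Set where
  field
    len     : ℕ
    vert    : Fin (suc (suc (suc len))) → Fin (size G)
    inj     : Injective _≡_ _≡_ vert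
    step    : ∀ (i : Fin (suc (suc len))) → adj G (vert (inject₁ i)) (vert (suc i)) ≡ true
    close   : adj G (vert (fromℕ (suc (suc len)))) (vert zero) ≡ true
open Cycle public

InducesForest : (G : Graph) → (Fin (size G) → Set) → Set
InducesForest G S = ¬ (Σ (Cycle G) λ c → ∀ i → S (vert c i))

-- Partition of V(G) into m (possibly empty) parts, given by a part map.
Partition : Graph → ℕ → Set
Partition G m = Fin (size G) → Fin m

partSize : (G : Graph) {m : ℕ} → Partition G m → Fin m → ℕ
partSize G p i = L.length (L.filter (λ v → p v ≟ i) (L.allFin (size G)))

Equitable : (G : Graph) {m : ℕ} → Partition G m → Set
Equitable G p = ∀ i j → partSize G p i ≤ partSize G p j + 1

IntoInducedForests : (G : Graph) {m : ℕ} → Partition G m → Set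
IntoInducedForests G p = ∀ i → InducesForest G (λ v → p v ≡ i)

EquitableForestPartition : Graph → ℕ → Set
EquitableForestPartition G m =
  Σ (Partition G m) λ p → Equitable G p × IntoInducedForests G p

-- Add one part at a time. Write n = |G| = q (k + 1) + r with r ≤ k. In an equitable partition of G
-- into k induced forests every part has at least q vertices, so some q vertices S lie inside one
-- part and induce a forest. G − S has q k + r vertices and stays in the class, so it has an
-- equitable partition into k induced forests, whose parts therefore have q or q + 1 vertices;
-- adding S as a (k+1)-st part gives an equitable partition of G into k + 1 induced forests.

module Submission where

open import Defs
open import Data.Nat using (ℕ; zero; suc; _+_; _*_; _≤_; _<_; _≤′_; ≤′-refl; ≤′-step; z≤n; s≤s⁻¹)
open import Data.Nat.Properties hiding (_≟_)
open import Data.Nat.DivMod using (_/_; _%_; m≡m%n+[m/n]*n; m%n<n; m/n*n≤m)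
open import Data.Nat.Tactic.RingSolver using (solve-∀)
open import Data.Fin using (Fin; zero; suc; _≟_; fromℕ<)
import Data.Fin.Properties as Fin
open import Data.Bool using (Bool; true; false; not; if_then_else_)
open import Data.Bool.Properties using (not-involutive; not-injective)
open import Data.Product using (∃; _×_; _,_; proj₁; proj₂)
open import Data.Vec.Functional using (Vector)
open import Data.List using (length; filter; tabulate)
open import Function using (_∘_; id)
open import Function.Definitions using (Injective)
open import Relation.Nullary using (does; yes; no; contradiction)
open import Relation.Nullary.Decidable using (dec-false)
open import Relation.Unary using (Decidable)
open import Relation.Binary.PropositionalEquality as ≡ using (_≡_; refl; cong; cong₂; subst; _≗_)
open import Algebra.Properties.CommutativeMonoid.Sum +-0-commutativeMonoid
  using (sum; sum-syntax; ∑-distrib-+; ∑-comm; sum-cong-≗)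

sum-const : ∀ n c → ∑[ i < n ] c ≡ n * c
sum-const zero    c = refl
sum-const (suc n) c = cong (c +_) (sum-const n c)

sum-mono-≤ : ∀ {n} {f g : Vector ℕ n} → (∀ i → f i ≤ g i) → sum f ≤ sum g
sum-mono-≤ {zero}  f≤g = z≤n
sum-mono-≤ {suc n} f≤g = +-mono-≤ (f≤g zero) (sum-mono-≤ (f≤g ∘ suc))

sum-mono-< : ∀ {n} {f g : Vector ℕ n} → (∀ i → f i ≤ g i) → ∀ j → f j < g j → sum f < sum g
sum-mono-< f≤g zero    fj<gj = +-mono-<-≤ fj<gj (sum-mono-≤ (f≤g ∘ suc))
sum-mono-< f≤g (suc j) fj<gj = +-mono-≤-< (f≤g zero) (sum-mono-< (f≤g ∘ suc) j fj<gj)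

module _ {k} (f : Fin k → ℕ) (balanced : ∀ i j → f i ≤ f j + 1) where

  balanced-lower : ∀ {q} → k * q ≤ sum f → ∀ j → q ≤ f j
  balanced-lower {q} kq≤Σf j = ≮⇒≥ λ fj<q →
    let fi<q i = ≤-trans (balanced i j) (subst (_≤ q) (+-comm 1 (f j)) fj<q)
    in <⇒≱ (subst (sum f <_) (sum-const k q) (sum-mono-< fi<q j fj<q)) kq≤Σf

  balanced-upper : ∀ {q} → sum f ≤ k * suc q → ∀ j → f j ≤ suc q
  balanced-upper {q} Σf≤k[q+1] j = ≮⇒≥ λ q+1<fj →
    let q+1≤fi i = s≤s⁻¹ (≤-trans q+1<fj (subst (f j ≤_) (+-comm (f i) 1) (balanced j i)))
    in <⇒≱ (subst (_< sum f) (sum-const k (suc q)) (sum-mono-< q+1≤fi j q+1<fj)) Σf≤k[q+1]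

bounded⇒balanced : ∀ {k} (f : Fin k → ℕ) q → (∀ i → q ≤ f i × f i ≤ suc q) → ∀ i j → f i ≤ f j + 1
bounded⇒balanced f q bounds i j =
  ≤-trans (proj₂ (bounds i)) (subst (_≤ f j + 1) (+-comm q 1) (+-monoˡ-≤ 1 (proj₁ (bounds j))))

𝟙 : Bool → ℕ
𝟙 true  = 1
𝟙 false = 0

count : ∀ {n} → (Fin n → Bool) → ℕ
count b = sum (𝟙 ∘ b)

count-cong : ∀ {n} {b c : Fin n → Bool} → b ≗ c → count b ≡ count c
count-cong b≗c = sum-cong-≗ (cong 𝟙 ∘ b≗c)

count-+-count-not : ∀ {n} (b : Fin n → Bool) → count b + count (not ∘ b) ≡ n
count-+-count-not {n} b = begin
  count b + count (not ∘ b)              ≡⟨ ∑-distrib-+ (𝟙 ∘ b) (𝟙 ∘ not ∘ b) ⟨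
  ∑[ v < n ] (𝟙 (b v) + 𝟙 (not (b v)))   ≡⟨ sum-cong-≗ (𝟙-+-𝟙-not ∘ b) ⟩
  ∑[ v < n ] 1                           ≡⟨ sum-const n 1 ⟩
  n * 1                                  ≡⟨ *-identityʳ n ⟩
  n                                      ∎
  where
  open ≡.≡-Reasoning
  𝟙-+-𝟙-not : ∀ x → 𝟙 x + 𝟙 (not x) ≡ 1
  𝟙-+-𝟙-not true  = refl
  𝟙-+-𝟙-not false = refl

length-filter-tabulate : ∀ {A : Set} {P : A → Set} (P? : Decidable P) {n} (f : Fin n → A) →
  length (filter P? (tabulate f)) ≡ count (does ∘ P? ∘ f)
length-filter-tabulate P? {zero}  f = refl
length-filter-tabulate P? {suc n} f with does (P? (f zero))
... | true  = cong suc (length-filter-tabulate P? (f ∘ suc))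
... | false = length-filter-tabulate P? (f ∘ suc)

partSize-count : ∀ G {k} (p : Partition G k) i → partSize G p i ≡ count (λ v → does (p v ≟ i))
partSize-count G p i = length-filter-tabulate (λ v → p v ≟ i) id

sum-𝟙-≟ : ∀ {k} (x : Fin k) → ∑[ i < k ] 𝟙 (does (x ≟ i)) ≡ 1
sum-𝟙-≟ {suc k} zero    = cong suc (≡.trans (sum-const k 0) (*-zeroʳ k))
sum-𝟙-≟         (suc x) = sum-𝟙-≟ x

sum-partSize : ∀ G {k} (p : Partition G k) → ∑[ i < k ] partSize G p i ≡ size G
sum-partSize G {k} p = begin
  ∑[ i < k ] partSize G p i                       ≡⟨ sum-cong-≗ (partSize-count G p) ⟩
  ∑[ i < k ] ∑[ v < size G ] 𝟙 (does (p v ≟ i))   ≡⟨ ∑-comm (λ i v → 𝟙 (does (p v ≟ i))) ⟩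
  ∑[ v < size G ] ∑[ i < k ] 𝟙 (does (p v ≟ i))   ≡⟨ sum-cong-≗ (sum-𝟙-≟ ∘ p) ⟩
  ∑[ v < size G ] 1                               ≡⟨ sum-const (size G) 1 ⟩
  size G * 1                                      ≡⟨ *-identityʳ (size G) ⟩
  size G                                          ∎
  where open ≡.≡-Reasoning

choose : ∀ {n} → (Fin n → Bool) → ℕ → Fin n → Bool
choose b zero    _       = false
choose b (suc q) zero    = b zero
choose b (suc q) (suc v) = choose (b ∘ suc) (if b zero then q else suc q) v

choose-⊆ : ∀ {n} (b : Fin n → Bool) q v → choose b q v ≡ true → b v ≡ true
choose-⊆ b (suc q) zero    chosen = chosen
choose-⊆ b (suc q) (suc v) chosen = choose-⊆ (b ∘ suc) (if b zero then q else suc q) v chosen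

count-choose : ∀ {n} (b : Fin n → Bool) q → q ≤ count b → count (choose b q) ≡ q
count-choose {zero}  b zero    z≤n = refl
count-choose {suc n} b zero    _   = ≡.trans (sum-const (suc n) 0) (*-zeroʳ (suc n))
count-choose {suc n} b (suc q) q<count with b zero
... | true  = cong suc (count-choose (b ∘ suc) q (s≤s⁻¹ q<count))
... | false = count-choose (b ∘ suc) (suc q) q<count

enum : ∀ {n} (keep : Fin n → Bool) → Fin (count keep) → Fin n
enum {suc n} keep i with keep zero
enum keep zero    | true  = zero
enum keep (suc i) | true  = suc (enum (keep ∘ suc) i)
enum keep i       | false = suc (enum (keep ∘ suc) i)

enum-injective : ∀ {n} (keep : Fin n → Bool) → Injective _≡_ _≡_ (enum keep)
enum-injective {suc n} keep {i} {j} eq with keep zero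
enum-injective keep {zero}  {zero}  eq | true  = refl
enum-injective keep {suc i} {suc j} eq | true  = cong suc (enum-injective (keep ∘ suc) (Fin.suc-injective eq))
enum-injective keep {i}     {j}     eq | false = enum-injective (keep ∘ suc) (Fin.suc-injective eq)

enum-surjective : ∀ {n} (keep : Fin n → Bool) v → keep v ≡ true → ∃ λ i → enum keep i ≡ v
enum-surjective keep zero kept with keep zero
enum-surjective keep zero kept | true = zero , refl
enum-surjective keep zero ()   | false
enum-surjective keep (suc v) kept with keep zero | enum-surjective (keep ∘ suc) v kept
... | true  | i , e = suc i , cong suc e
... | false | i , e = i , cong suc e

extend : ∀ {A : Set} {n} (keep : Fin n → Bool) → (Fin (count keep) → A) → A → Fin n → A
extend {n = suc n} keep g d v with keep zero
extend keep g d zero    | true  = g zero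
extend keep g d (suc v) | true  = extend (keep ∘ suc) (g ∘ suc) d v
extend keep g d zero    | false = d
extend keep g d (suc v) | false = extend (keep ∘ suc) g d v

extend-enum : ∀ {A : Set} {n} (keep : Fin n → Bool) (g : Fin (count keep) → A) d i →
  extend keep g d (enum keep i) ≡ g i
extend-enum {n = suc n} keep g d i with keep zero
extend-enum keep g d zero    | true  = refl
extend-enum keep g d (suc i) | true  = extend-enum (keep ∘ suc) (g ∘ suc) d i
extend-enum keep g d i       | false = extend-enum (keep ∘ suc) g d i

extend-dropped : ∀ {A : Set} {n} (keep : Fin n → Bool) (g : Fin (count keep) → A) d v →
  keep v ≡ false → extend keep g d v ≡ d
extend-dropped keep g d zero dropped with keep zero
extend-dropped keep g d zero ()      | true
extend-dropped keep g d zero dropped | false = refl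
extend-dropped keep g d (suc v) dropped with keep zero
... | true  = extend-dropped (keep ∘ suc) (g ∘ suc) d v dropped
... | false = extend-dropped (keep ∘ suc) g d v dropped

count-extend : ∀ {A : Set} {n} (keep : Fin n → Bool) (g : Fin (count keep) → A) d (B : A → Bool) →
  B d ≡ false → count (B ∘ extend keep g d) ≡ count (B ∘ g)
count-extend {n = zero}  keep g d B Bd = refl
count-extend {n = suc n} keep g d B Bd with keep zero
... | true  = cong (𝟙 (B (g zero)) +_) (count-extend (keep ∘ suc) (g ∘ suc) d B Bd)
... | false = cong₂ _+_ (cong 𝟙 Bd) (count-extend (keep ∘ suc) g d B Bd)

induced : (G : Graph) → (Fin (size G) → Bool) → Graph
induced G keep = record
  { size   = count keep
  ; adj    = λ u v → adj G (enum keep u) (enum keep v)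
  ; sym    = λ u v → sym G (enum keep u) (enum keep v)
  ; irrefl = irrefl G ∘ enum keep
  }

induced-≤ind : ∀ G keep → induced G keep ≤ind G
induced-≤ind G keep = enum keep , enum-injective keep , λ _ _ → refl

pullback-cycle : ∀ {G H} (H↪G : H ≤ind G) (c : Cycle G) (u : Fin (suc (suc (suc (len c)))) → Fin (size H)) →
  (∀ t → proj₁ H↪G (u t) ≡ vert c t) → Cycle H
pullback-cycle {G} {H} (f , _ , f-adj) c u f∘u = record
  { len   = len c
  ; vert  = u
  ; inj   = λ {s} {t} e → inj c (≡.trans (≡.sym (f∘u s)) (≡.trans (cong f e) (f∘u t)))
  ; step  = λ i → ≡.trans (adj-u _ _) (step c i)
  ; close = ≡.trans (adj-u _ _) (close c)
  }
  where
  adj-u : ∀ s t → adj H (u s) (u t) ≡ adj G (vert c s) (vert c t)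
  adj-u s t = ≡.trans (≡.sym (f-adj (u s) (u t))) (cong₂ (adj G) (f∘u s) (f∘u t))

InducesForest-⊆ : ∀ G {S T : Fin (size G) → Set} → (∀ v → T v → S v) → InducesForest G S → InducesForest G T
InducesForest-⊆ G T⊆S forest (c , inT) = forest (c , λ t → T⊆S (vert c t) (inT t))

module _ (G : Graph) (keep : Fin (size G) → Bool) {k} (p′ : Partition (induced G keep) k) where

  addPart : Partition G (suc k)
  addPart = extend keep (suc ∘ p′) zero

  addPart-kept : ∀ v → keep v ≡ true → ∃ λ i → enum keep i ≡ v × addPart v ≡ suc (p′ i)
  addPart-kept v kept with i , refl ← enum-surjective keep v kept = i , refl , extend-enum keep (suc ∘ p′) zero i

  addPart-zero⁻¹ : ∀ v → addPart v ≡ zero → keep v ≡ false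
  addPart-zero⁻¹ v v∈0 with keep v in kept
  ... | false = refl
  ... | true with addPart-kept v kept
  ...   | _ , _ , v∈i = contradiction (≡.trans (≡.sym v∈0) v∈i) λ ()

  addPart-suc⁻¹ : ∀ v j → addPart v ≡ suc j → ∃ λ i → enum keep i ≡ v × p′ i ≡ j
  addPart-suc⁻¹ v j v∈j with keep v in kept
  ... | false = contradiction (≡.trans (≡.sym v∈j) (extend-dropped keep (suc ∘ p′) zero v kept)) λ ()
  ... | true with addPart-kept v kept
  ...   | i , i↦v , v∈i = i , i↦v , Fin.suc-injective (≡.trans (≡.sym v∈i) v∈j)

  partSize-addPart-zero : partSize G addPart zero ≡ count (not ∘ keep)
  partSize-addPart-zero = ≡.trans (partSize-count G addPart zero) (count-cong in-zero)
    where
    in-zero : ∀ v → does (addPart v ≟ zero) ≡ not (keep v)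
    in-zero v with keep v in kept
    ... | false = cong (λ x → does (x ≟ zero)) (extend-dropped keep (suc ∘ p′) zero v kept)
    ... | true  = dec-false (addPart v ≟ zero) λ v∈0 → contradiction (≡.trans (≡.sym kept) (addPart-zero⁻¹ v v∈0)) λ ()

  partSize-addPart-suc : ∀ j → partSize G addPart (suc j) ≡ partSize (induced G keep) p′ j
  partSize-addPart-suc j = begin
    partSize G addPart (suc j)                               ≡⟨ partSize-count G addPart (suc j) ⟩
    count (λ v → does (addPart v ≟ suc j))                   ≡⟨ count-extend keep (suc ∘ p′) zero (λ x → does (x ≟ suc j)) refl ⟩
    count (λ i → does (p′ i ≟ j))                            ≡⟨ partSize-count (induced G keep) p′ j ⟨
    partSize (induced G keep) p′ j                           ∎
    where open ≡.≡-Reasoning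

  addPart-forests : InducesForest G (λ v → keep v ≡ false) → IntoInducedForests (induced G keep) p′ →
    IntoInducedForests G addPart
  addPart-forests dropped-forest p′-forests zero    = InducesForest-⊆ G addPart-zero⁻¹ dropped-forest
  addPart-forests dropped-forest p′-forests (suc j) (c , c∈j) =
    p′-forests j (pullback-cycle (induced-≤ind G keep) c (proj₁ ∘ preimage) (proj₁ ∘ proj₂ ∘ preimage) ,
                  proj₂ ∘ proj₂ ∘ preimage)
    where
    preimage : ∀ t → ∃ λ i → enum keep i ≡ vert c t × p′ i ≡ j
    preimage t = addPart-suc⁻¹ (vert c t) j (c∈j t)

k*[n/1+k]≤n : ∀ n k → k * (n / suc k) ≤ n
k*[n/1+k]≤n n k = begin
  k * q      ≡⟨ *-comm k q ⟩
  q * k      ≤⟨ *-monoʳ-≤ q (n≤1+n k) ⟩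
  q * suc k  ≤⟨ m/n*n≤m n (suc k) ⟩
  n          ∎
  where
  open ≤-Reasoning
  q = n / suc k

complement-of-quotient : ∀ n k {m} → m + n / suc k ≡ n → k * (n / suc k) ≤ m × m ≤ k * suc (n / suc k)
complement-of-quotient n k {m} m+q≡n =
  subst (k * q ≤_) (≡.sym m≡r+kq) (m≤n+m (k * q) r) ,
  subst (_≤ k * suc q) (≡.sym m≡r+kq) (≤-trans (+-monoˡ-≤ (k * q) r≤k) (≤-reflexive (≡.sym (*-suc k q))))
  where
  q = n / suc k
  r = n % suc k
  r≤k : r ≤ k
  r≤k = s≤s⁻¹ (m%n<n n (suc k))
  regroup : ∀ r q k → r + q * suc k ≡ r + k * q + q
  regroup = solve-∀
  m≡r+kq : m ≡ r + k * q
  m≡r+kq = +-cancelʳ-≡ q m (r + k * q)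
    (≡.trans m+q≡n (≡.trans (m≡m%n+[m/n]*n n (suc k)) (regroup r q k)))

forest-of-size : ∀ G {k} → 1 ≤ k → EquitableForestPartition G k → ∀ q → k * q ≤ size G →
  ∃ λ (S : Fin (size G) → Bool) → count S ≡ q × InducesForest G (λ v → S v ≡ true)
forest-of-size G {k} 1≤k (p , p-balanced , p-forests) q kq≤n =
  choose inPart₀ q , count-choose inPart₀ q q≤|part₀| , InducesForest-⊆ G S⊆part₀ (p-forests i₀)
  where
  i₀ : Fin k
  i₀ = fromℕ< 1≤k
  inPart₀ : Fin (size G) → Bool
  inPart₀ v = does (p v ≟ i₀)
  q≤|part₀| : q ≤ count inPart₀
  q≤|part₀| = subst (q ≤_) (partSize-count G p i₀)
    (balanced-lower (partSize G p) p-balanced (subst (k * q ≤_) (≡.sym (sum-partSize G p)) kq≤n) i₀)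
  S⊆part₀ : ∀ v → choose inPart₀ q v ≡ true → p v ≡ i₀
  S⊆part₀ v v∈S with p v ≟ i₀ | choose-⊆ inPart₀ q v v∈S
  ... | yes pv≡i₀ | _  = pv≡i₀
  ... | no _      | ()

module _ {C : Graph → Set} (hereditary : Hereditary C) {k} (1≤k : 1 ≤ k)
         (partition : ∀ G → C G → EquitableForestPartition G k) where

  equitableForestPartition-suc : ∀ G → C G → EquitableForestPartition G (suc k)
  equitableForestPartition-suc G G∈C =
    P , bounded⇒balanced (partSize G P) q P-bounds , addPart-forests G keep p′ dropped-forest p′-forests
    where
    q = size G / suc k
    S-of-size-q = forest-of-size G 1≤k (partition G G∈C) q (k*[n/1+k]≤n (size G) k)
    S = proj₁ S-of-size-q
    keep = not ∘ S
    |dropped|≡q : count (not ∘ keep) ≡ q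
    |dropped|≡q = ≡.trans (count-cong (not-involutive ∘ S)) (proj₁ (proj₂ S-of-size-q))
    dropped-forest : InducesForest G (λ v → keep v ≡ false)
    dropped-forest = InducesForest-⊆ G (λ v → not-injective {S v} {true}) (proj₂ (proj₂ S-of-size-q))

    H = induced G keep
    H-partition = partition H (hereditary G H G∈C (induced-≤ind G keep))
    p′ = proj₁ H-partition
    p′-balanced = proj₁ (proj₂ H-partition)
    p′-forests = proj₂ (proj₂ H-partition)
    P = addPart G keep p′

    |H|-bounds = complement-of-quotient (size G) k
      (≡.trans (cong (count keep +_) (≡.sym |dropped|≡q)) (count-+-count-not keep))
    Σ|p′|≡|H| = sum-partSize H p′

    P-bounds : ∀ i → q ≤ partSize G P i × partSize G P i ≤ suc q
    P-bounds zero    rewrite partSize-addPart-zero G keep p′ | |dropped|≡q = ≤-refl , n≤1+n q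
    P-bounds (suc j) rewrite partSize-addPart-suc G keep p′ j =
      balanced-lower (partSize H p′) p′-balanced (subst (k * q ≤_) (≡.sym Σ|p′|≡|H|) (proj₁ |H|-bounds)) j ,
      balanced-upper (partSize H p′) p′-balanced (subst (_≤ k * suc q) (≡.sym Σ|p′|≡|H|) (proj₂ |H|-bounds)) j

lemma10 : (ℓ : ℕ) → 1 ≤ ℓ → (C : Graph → Set) → Hereditary C →
    (∀ G → C G → EquitableForestPartition G ℓ) →
    ∀ (k : ℕ) → ℓ ≤ k → ∀ G → C G → EquitableForestPartition G k
lemma10 ℓ 1≤ℓ C hereditary base k ℓ≤k = go (≤⇒≤′ ℓ≤k)
  where
  go : ∀ {k} → ℓ ≤′ k → ∀ G → C G → EquitableForestPartition G k
  go ≤′-refl        = base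
  go (≤′-step ℓ≤′k) = equitableForestPartition-suc hereditary (≤-trans 1≤ℓ (≤′⇒≤ ℓ≤′k)) (go ℓ≤′k)
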